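{- Let $(X,\mathcal{R})$ be an imprimitive symmetric association scheme with $6$ classes, cometric with respect to the ordering $E_0,\dots,E_6$, with $m=\operatorname{rank}(E_1)>2$ and Krein array \[ \{ m,\,m-1,\,1,\,b_3^*,\,b_4^*,\,1;\ 1,\,c_2^*,\,c_3^*,\,1,\,c_5^*,\,m\},\qquad c_3^*=m-b_3^*, \] and with $a_2^*=a_4^*+a_5^*$, where $a_i^*=m-b_i^*-c_i^*$ (with $b_6^*=0$, $c_0^*=0$). Define polynomials $v_0^*,\dots,v_7^*$ by $v_0^*(x)=1$, $v_1^*(x)=x$, and \[ x\,v_i^*(x)=c_{i+1}^*v_{i+1}^*(x)+a_i^*v_i^*(x)+b_{i-1}^*v_{i-1}^*(x)\qquad(1\le i\le 6), \] where one formally sets $c_7^*=1$. Then \[ m\,c_2^*c_3^*c_5^*\,v_7^*(x)=\bigl(x^3-a_2^*x^2-(m+c_2^*(m-1))x+ma_2^*-a_5^*c_3^*\bigr)\,(x^2+c_2^*x-m)\,(x-m)\,(x+1). \]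
   Context: A symmetric association scheme $(X,\mathcal{R})$ with $d$ classes has adjacency matrices $A_0=I,A_1,\dots,A_d$ summing to $J$ whose span is closed under multiplication; its primitive idempotents are $E_0=\frac1{|X|}J,E_1,\dots,E_d$, and Krein parameters $q_{ij}^h$ are defined by $E_i\circ E_j=\frac1{|X|}\sum_h q_{ij}^hE_h$ ($\circ$ = entrywise product). It is imprimitive if some $(X,R_i)$, $i\ge1$, is disconnected. It is cometric with respect to $E_0,\dots,E_d$ if $q_{ij}^h=0$ when $i+j<h$ and $q_{ij}^h\ne0$ when $i+j=h$; then $a_i^*=q_{1i}^i$, $b_i^*=q_{1,i+1}^i$, $c_i^*=q_{1,i-1}^i$, and the Krein array is $\{b_0^*,\dots,b_{d-1}^*;c_1^*,\dots,c_d^*\}$. -}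

module Defs where

open import Level using (_⊔_)
open import Data.Nat as ℕ using (ℕ; zero; suc)
open import Data.Fin as Fin using (Fin; #_; toℕ)
open import Data.Bool using (if_then_else_)
open import Data.Product using (Σ; ∃; _×_; _,_)
open import Relation.Nullary using (¬_; Dec; yes; no)
open import Relation.Nullary.Decidable using (⌊_⌋)
open import Relation.Binary.PropositionalEquality using (_≡_; _≢_)
open import Relation.Binary.Construct.Closure.ReflexiveTransitive using (Star)
open import Algebra.Bundles using (CommutativeRing)

module _ {c ℓ} (F : CommutativeRing c ℓ) where
  open CommutativeRing F

  ℕ→F : ℕ → Carrier
  ℕ→F zero = 0#
  ℕ→F (suc k) = 1# + ℕ→F k

  IsFieldCR : Set (c ⊔ ℓ)
  IsFieldCR = ∀ a → ¬ (a ≈ 0#) → Σ Carrier λ b → a * b ≈ 1#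

  CharZero : Set ℓ
  CharZero = ∀ k → ¬ (ℕ→F (suc k) ≈ 0#)

  Σ[_] : ∀ {k} → (Fin k → Carrier) → Carrier
  Σ[_] {zero} f = 0#
  Σ[_] {suc k} f = f Fin.zero + Σ[_] (λ i → f (Fin.suc i))

  Mat : ℕ → Set c
  Mat n = Fin n → Fin n → Carrier

  _≋_ : ∀ {n} → Mat n → Mat n → Set ℓ
  A ≋ B = ∀ x y → A x y ≈ B x y

  _⊗_ : ∀ {n} → Mat n → Mat n → Mat n
  (A ⊗ B) x y = Σ[ (λ z → A x z * B z y) ]

  𝟘 𝟙 : ∀ {n} → Mat n
  𝟘 x y = 0#
  𝟙 x y = if ⌊ x Fin.≟ y ⌋ then 1# else 0#

  lincomb : ∀ {n k} → (Fin k → Carrier) → (Fin k → Mat n) → Mat n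
  lincomb a M x y = Σ[ (λ h → a h * M h x y) ]

  -- rank: the least r such that A = P Q with P an n×r and Q an r×n matrix
  FactorsThrough : ∀ {n} → ℕ → Mat n → Set (c ⊔ ℓ)
  FactorsThrough {n} r A =
    Σ (Fin n → Fin r → Carrier) λ P → Σ (Fin r → Fin n → Carrier) λ Q →
      ∀ x y → A x y ≈ Σ[ (λ k → P x k * Q k y) ]

  HasRank : ∀ {n} → Mat n → ℕ → Set (c ⊔ ℓ)
  HasRank A m = FactorsThrough m A × (∀ r → FactorsThrough r A → m ℕ.≤ r)

  -- A symmetric association scheme with d classes on X = Fin n.
  -- rel x y = i means (x,y) ∈ R_i.
  record SymAssocScheme (n d : ℕ) : Set (c ⊔ ℓ) where
    field
      rel       : Fin n → Fin n → Fin (suc d)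
      rel-refl  : ∀ x → rel x x ≡ Fin.zero
      rel-diag  : ∀ x y → rel x y ≡ Fin.zero → x ≡ y
      rel-sym   : ∀ x y → rel x y ≡ rel y x
      rel-nonempty : ∀ i → Σ (Fin n) λ x → Σ (Fin n) λ y → rel x y ≡ i
    A : Fin (suc d) → Mat n
    A i x y = if ⌊ rel x y Fin.≟ i ⌋ then 1# else 0#
    field
      closed : ∀ i j → Σ (Fin (suc d) → Carrier) λ p → (A i ⊗ A j) ≋ lincomb p A

    Connected : Fin (suc d) → Set
    Connected i = ∀ x y → Star (λ u v → rel u v ≡ i) x y

    Imprimitive : Set
    Imprimitive = Σ (Fin (suc d)) λ i → i ≢ Fin.zero × ¬ Connected i

  record PrimitiveIdempotents {n d : ℕ} (S : SymAssocScheme n d)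
                              (E : Fin (suc d) → Mat n) : Set (c ⊔ ℓ) where
    open SymAssocScheme S
    field
      inBM     : ∀ i → Σ (Fin (suc d) → Carrier) λ p → E i ≋ lincomb p A
      idem     : ∀ i → (E i ⊗ E i) ≋ E i
      orth     : ∀ i j → i ≢ j → (E i ⊗ E j) ≋ 𝟘
      complete : lincomb (λ _ → 1#) E ≋ 𝟙
      nonzero  : ∀ i → ¬ (E i ≋ 𝟘)
      E₀       : ∀ x y → ℕ→F n * E Fin.zero x y ≈ 1#

  KreinParameters : ∀ {n d} → (Fin (suc d) → Mat n) →
                    (Fin (suc d) → Fin (suc d) → Fin (suc d) → Carrier) → Set ℓ
  KreinParameters {n} E q =
    ∀ i j x y → ℕ→F n * (E i x y * E j x y) ≈ Σ[ (λ h → q i j h * E h x y) ]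

  Cometric : ∀ {d} → (Fin (suc d) → Fin (suc d) → Fin (suc d) → Carrier) → Set ℓ
  Cometric q =
    (∀ i j h → toℕ i ℕ.+ toℕ j ℕ.< toℕ h → q i j h ≈ 0#) ×
    (∀ i j h → toℕ i ℕ.+ toℕ j ≡ toℕ h → ¬ (q i j h ≈ 0#))

  -- Krein array entries for d = 6:  b_i* = q_{1,i+1}^i, c_i* = q_{1,i-1}^i,
  -- with b_6* = 0, c_0* = 0 and the formal convention c_7* = 1.
  module KreinArray (q : Fin 7 → Fin 7 → Fin 7 → Carrier) (m : ℕ) where
    b* : ℕ → Carrier
    b* 0 = q (# 1) (# 1) (# 0)
    b* 1 = q (# 1) (# 2) (# 1)
    b* 2 = q (# 1) (# 3) (# 2)
    b* 3 = q (# 1) (# 4) (# 3)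
    b* 4 = q (# 1) (# 5) (# 4)
    b* 5 = q (# 1) (# 6) (# 5)
    b* _ = 0#

    c* : ℕ → Carrier
    c* 0 = 0#
    c* 1 = q (# 1) (# 0) (# 1)
    c* 2 = q (# 1) (# 1) (# 2)
    c* 3 = q (# 1) (# 2) (# 3)
    c* 4 = q (# 1) (# 3) (# 4)
    c* 5 = q (# 1) (# 4) (# 5)
    c* 6 = q (# 1) (# 5) (# 6)
    c* 7 = 1#
    c* _ = 0#

    a* : ℕ → Carrier
    a* i = ℕ→F m - b* i - c* i

module Submission where

-- For any sequences a, b, c in a commutative ring, a solution v of
--   x v_{k+1} = c_{k+2} v_{k+2} + a_{k+1} v_{k+1} + b_k v_k ,  v₀ = 1, v₁ = x
-- satisfies (c₁⋯c_k) v_k = s_k(x), where s is given by the division-free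
-- recurrence  s_{k+2} = (x - a_{k+1}) s_{k+1} - b_k c_{k+1} s_k
-- (lemma scaled-solution).  Both s and c₁⋯c_k respect pointwise
-- equality of the parameter sequences, so we may replace the Krein array by
-- explicit expressions in the four free parameters m, c₂*, b₃*, c₅*; the
-- hypothesis a₂* = a₄* + a₅* is what determines b₄* = m - 1 + c₂* - c₅*.
-- For these explicit sequences the identity  s₇(x) = (factored form)  is a
-- polynomial identity in five variables, proved by the ring solver of the
-- library.
-- Only the recurrence and the relations among the Krein parameters enter
-- the argument.

open import Defs
open import Level using (Level)
open import Data.Nat using (ℕ; suc; _<_; _≤_)
open import Data.Fin using (Fin)
open import Data.Product using (_×_)
open import Algebra.Bundles using (CommutativeRing)

open import Data.Nat as ℕ using (zero; s≤s)
import Data.Nat.Properties as ℕ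
open import Data.Integer.Base as ℤ using (ℤ; +_; -[1+_]; _⊖_; _◃_; sign; ∣_∣)
import Data.Integer.Properties as ℤ
open import Data.Sign.Base as Sign using (Sign)
open import Data.Maybe.Base using (Maybe; map)
import Relation.Binary.PropositionalEquality as ≡
open import Relation.Binary.Consequences using (dec⇒weaklyDec)
open import Algebra.Solver.Ring.AlmostCommutativeRing
  using (fromCommutativeRing; _-Raw-AlmostCommutative⟶_)

module IntegerCoefficientSolver {c ℓ} (F : CommutativeRing c ℓ) where
  open CommutativeRing F
  open import Algebra.Properties.Ring ring using (-1*x≈-x; -0#≈0#; -‿involutive; -‿+-comm)
  open import Algebra.Properties.Semiring.Mult.TCOptimised semiring
    using (1+×; ×-homo-+; ×1-homo-*) renaming (_×_ to _·_)
  open import Algebra.Properties.CommutativeSemigroup *-commutativeSemigroup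
    using (interchange)
  open import Relation.Binary.Reasoning.Setoid setoid

  ⟦_⟧ℤ : ℤ → Carrier
  ⟦ + n ⟧ℤ      = n · 1#
  ⟦ -[1+ n ] ⟧ℤ = - (suc n · 1#)

  ⟦⟧-neg : ∀ i → ⟦ ℤ.- i ⟧ℤ ≈ - ⟦ i ⟧ℤ
  ⟦⟧-neg -[1+ n ]  = sym (-‿involutive _)
  ⟦⟧-neg (+ zero)  = sym -0#≈0#
  ⟦⟧-neg (+ suc n) = refl

  cancel-1 : ∀ a b → (1# + a) - (1# + b) ≈ a - b
  cancel-1 a b = begin
    (1# + a) + - (1# + b)  ≈⟨ +-congˡ (sym (-‿+-comm 1# b)) ⟩
    (1# + a) + (- 1# + - b) ≈⟨ interchange+ 1# a (- 1#) (- b) ⟩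
    (1# - 1#) + (a - b)    ≈⟨ +-congʳ (-‿inverseʳ 1#) ⟩
    0# + (a - b)           ≈⟨ +-identityˡ _ ⟩
    a - b                  ∎
    where open import Algebra.Properties.CommutativeSemigroup +-commutativeSemigroup
            renaming (interchange to interchange+)

  ⟦⟧-⊖ : ∀ m n → ⟦ m ⊖ n ⟧ℤ ≈ m · 1# - n · 1#
  ⟦⟧-⊖ zero    zero    = sym (-‿inverseʳ 0#)
  ⟦⟧-⊖ zero    (suc n) = sym (+-identityˡ _)
  ⟦⟧-⊖ (suc m) zero    = sym (trans (+-congˡ -0#≈0#) (+-identityʳ _))
  ⟦⟧-⊖ (suc m) (suc n) = begin
    ⟦ suc m ⊖ suc n ⟧ℤ               ≡⟨ ≡.cong ⟦_⟧ℤ (ℤ.[1+m]⊖[1+n]≡m⊖n m n) ⟩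
    ⟦ m ⊖ n ⟧ℤ                       ≈⟨ ⟦⟧-⊖ m n ⟩
    m · 1# - n · 1#                  ≈⟨ cancel-1 _ _ ⟨
    (1# + m · 1#) - (1# + n · 1#)    ≈⟨ +-cong (1+× m 1#) (-‿cong (1+× n 1#)) ⟨
    suc m · 1# - suc n · 1#          ∎

  ⟦⟧-+ : ∀ i j → ⟦ i ℤ.+ j ⟧ℤ ≈ ⟦ i ⟧ℤ + ⟦ j ⟧ℤ
  ⟦⟧-+ -[1+ m ] -[1+ n ] = begin
    - (suc (suc (m ℕ.+ n)) · 1#)       ≡⟨ ≡.cong (λ k → - (k · 1#)) (≡.cong suc (ℕ.+-suc m n)) ⟨
    - ((suc m ℕ.+ suc n) · 1#)         ≈⟨ -‿cong (×-homo-+ 1# (suc m) (suc n)) ⟩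
    - (suc m · 1# + suc n · 1#)        ≈⟨ -‿+-comm _ _ ⟨
    - (suc m · 1#) + - (suc n · 1#)    ∎
  ⟦⟧-+ -[1+ m ] (+ n) = trans (⟦⟧-⊖ n (suc m)) (+-comm _ _)
  ⟦⟧-+ (+ m) -[1+ n ] = ⟦⟧-⊖ m (suc n)
  ⟦⟧-+ (+ m) (+ n)    = ×-homo-+ 1# m n

  σ : Sign → Carrier
  σ Sign.+ = 1#
  σ Sign.- = - 1#

  σ-* : ∀ s t → σ (s Sign.* t) ≈ σ s * σ t
  σ-* Sign.+ t      = sym (*-identityˡ _)
  σ-* Sign.- Sign.+ = sym (*-identityʳ _)
  σ-* Sign.- Sign.- = sym (trans (-1*x≈-x (- 1#)) (-‿involutive 1#))

  ⟦⟧-◃ : ∀ s n → ⟦ s ◃ n ⟧ℤ ≈ σ s * (n · 1#)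
  ⟦⟧-◃ s      zero    = sym (zeroʳ _)
  ⟦⟧-◃ Sign.+ (suc n) = sym (*-identityˡ _)
  ⟦⟧-◃ Sign.- (suc n) = sym (-1*x≈-x _)

  ⟦⟧-signAbs : ∀ i → ⟦ i ⟧ℤ ≈ σ (sign i) * (∣ i ∣ · 1#)
  ⟦⟧-signAbs i = trans (reflexive (≡.cong ⟦_⟧ℤ (≡.sym (ℤ.◃-inverse i)))) (⟦⟧-◃ (sign i) ∣ i ∣)

  ⟦⟧-* : ∀ i j → ⟦ i ℤ.* j ⟧ℤ ≈ ⟦ i ⟧ℤ * ⟦ j ⟧ℤ
  ⟦⟧-* i j = begin
    ⟦ (sign i Sign.* sign j) ◃ (∣ i ∣ ℕ.* ∣ j ∣) ⟧ℤ               ≈⟨ ⟦⟧-◃ (sign i Sign.* sign j) (∣ i ∣ ℕ.* ∣ j ∣) ⟩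
    σ (sign i Sign.* sign j) * ((∣ i ∣ ℕ.* ∣ j ∣) · 1#)          ≈⟨ *-cong (σ-* (sign i) (sign j)) (×1-homo-* ∣ i ∣ ∣ j ∣) ⟩
    (σ (sign i) * σ (sign j)) * (∣ i ∣ · 1# * ∣ j ∣ · 1#)        ≈⟨ interchange _ _ _ _ ⟩
    (σ (sign i) * ∣ i ∣ · 1#) * (σ (sign j) * ∣ j ∣ · 1#)        ≈⟨ *-cong (⟦⟧-signAbs i) (⟦⟧-signAbs j) ⟨
    ⟦ i ⟧ℤ * ⟦ j ⟧ℤ                                              ∎

  homomorphism : ℤ.+-*-rawRing -Raw-AlmostCommutative⟶ fromCommutativeRing F
  homomorphism = record
    { ⟦_⟧    = ⟦_⟧ℤ
    ; +-homo = ⟦⟧-+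
    ; *-homo = ⟦⟧-*
    ; -‿homo = ⟦⟧-neg
    ; 0-homo = refl
    ; 1-homo = refl
    }

  coefficient≟ : ∀ i j → Maybe (⟦ i ⟧ℤ ≈ ⟦ j ⟧ℤ)
  coefficient≟ i j = map (λ { ≡.refl → refl }) (dec⇒weaklyDec ℤ._≟_ i j)

  open import Algebra.Solver.Ring ℤ.+-*-rawRing (fromCommutativeRing F) homomorphism coefficient≟ public
    using (solve; _:=_; con; _:+_; _:*_; :-_; _:-_)

module ThreeTermRecurrence {c ℓ} (F : CommutativeRing c ℓ) where
  open CommutativeRing F
  open import Algebra.Properties.Ring ring using (x≈y⇒x∙y⁻¹≈ε; x∙y⁻¹≈ε⇒x≈y)
  open IntegerCoefficientSolver F
  open import Relation.Binary.Reasoning.Setoid setoid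

  follows-from : ∀ {l r p q} k → l - r ≈ k * (p - q) → p ≈ q → l ≈ r
  follows-from {l} {r} {p} {q} k l-r≈k[p-q] p≈q = x∙y⁻¹≈ε⇒x≈y l r (begin
    l - r        ≈⟨ l-r≈k[p-q] ⟩
    k * (p - q)  ≈⟨ *-congˡ (x≈y⇒x∙y⁻¹≈ε p≈q) ⟩
    k * 0#       ≈⟨ zeroʳ k ⟩
    0#           ∎)

  leading : (ℕ → Carrier) → ℕ → Carrier
  leading c zero    = 1#
  leading c (suc k) = leading c k * c (suc k)

  -- s_k = c₁⋯c_k v_k, computed by a recurrence that needs no division
  scaled : Carrier → (a b c : ℕ → Carrier) → ℕ → Carrier
  scaled x a b c 0             = 1#
  scaled x a b c 1             = c 1 * x
  scaled x a b c (suc (suc k)) =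
    (x - a (suc k)) * scaled x a b c (suc k) - b k * c (suc k) * scaled x a b c k

  leading-cong : ∀ {c c′} → (∀ i → c i ≈ c′ i) → ∀ k → leading c k ≈ leading c′ k
  leading-cong c≈c′ zero    = refl
  leading-cong c≈c′ (suc k) = *-cong (leading-cong c≈c′ k) (c≈c′ (suc k))

  scaled-cong : ∀ {x a b c a′ b′ c′} →
    (∀ i → a i ≈ a′ i) → (∀ i → b i ≈ b′ i) → (∀ i → c i ≈ c′ i) →
    ∀ k → scaled x a b c k ≈ scaled x a′ b′ c′ k
  scaled-cong a≈ b≈ c≈ 0             = refl
  scaled-cong a≈ b≈ c≈ 1             = *-congʳ (c≈ 1)
  scaled-cong a≈ b≈ c≈ (suc (suc k)) =
    +-cong (*-cong (+-congˡ (-‿cong (a≈ (suc k)))) (scaled-cong a≈ b≈ c≈ (suc k)))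
           (-‿cong (*-cong (*-cong (b≈ k) (c≈ (suc k))) (scaled-cong a≈ b≈ c≈ k)))

  -- One step of the recurrence multiplied through by L c₁, where in use
  -- L c₁ = c₁⋯c_{k+1} and c₂ = c_{k+2}, so that c₂ v₂ is eliminated.
  recurrence-step : ∀ x L c₁ c₂ a₁ b₀ v₀ v₁ v₂ →
    x * v₁ ≈ c₂ * v₂ + a₁ * v₁ + b₀ * v₀ →
    L * c₁ * c₂ * v₂ ≈ (x - a₁) * (L * c₁ * v₁) - b₀ * c₁ * (L * v₀)
  recurrence-step x L c₁ c₂ a₁ b₀ v₀ v₁ v₂ = follows-from (- (L * c₁)) (solve 9
    (λ x L c₁ c₂ a₁ b₀ v₀ v₁ v₂ →
      L :* c₁ :* c₂ :* v₂ :- ((x :- a₁) :* (L :* c₁ :* v₁) :- b₀ :* c₁ :* (L :* v₀))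
      := :- (L :* c₁) :* (x :* v₁ :- (c₂ :* v₂ :+ a₁ :* v₁ :+ b₀ :* v₀)))
    refl x L c₁ c₂ a₁ b₀ v₀ v₁ v₂)

  scaled-solution : ∀ {x a b c} N (v : ℕ → Carrier) → v 0 ≈ 1# → v 1 ≈ x →
    (∀ k → k ≤ N →
      x * v (suc k) ≈ c (suc (suc k)) * v (suc (suc k)) + a (suc k) * v (suc k) + b k * v k) →
    ∀ k → k ≤ suc (suc N) → leading c k * v k ≈ scaled x a b c k
  scaled-solution N v v₀≈1 v₁≈x rec 0 _ = trans (*-identityˡ (v 0)) v₀≈1
  scaled-solution N v v₀≈1 v₁≈x rec 1 _ = *-cong (*-identityˡ _) v₁≈x
  scaled-solution {x} {a} {b} {c} N v v₀≈1 v₁≈x rec (suc (suc k)) (s≤s (s≤s k≤N)) = begin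
    leading c (suc (suc k)) * v (suc (suc k))
      ≈⟨ recurrence-step x (leading c k) _ _ _ _ (v k) _ _ (rec k k≤N) ⟩
    (x - a (suc k)) * (leading c (suc k) * v (suc k)) - b k * c (suc k) * (leading c k * v k)
      ≈⟨ +-cong (*-congˡ (solution (suc k) (s≤s (ℕ.m≤n⇒m≤1+n k≤N))))
                (-‿cong (*-congˡ (solution k (ℕ.m≤n⇒m≤1+n (ℕ.m≤n⇒m≤1+n k≤N))))) ⟩
    scaled x a b c (suc (suc k)) ∎
    where
    solution : ∀ j → j ≤ suc (suc N) → leading c j * v j ≈ scaled x a b c j
    solution = scaled-solution N v v₀≈1 v₁≈x rec

module SixClassKreinArray {c ℓ} (F : CommutativeRing c ℓ) where
  open CommutativeRing F
  open IntegerCoefficientSolver F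
  open ThreeTermRecurrence F

  a-cong : ∀ {M b b′ c c′} → b ≈ b′ → c ≈ c′ → M - b - c ≈ M - b′ - c′
  a-cong b≈b′ c≈c′ = +-cong (+-congˡ (-‿cong b≈b′)) (-‿cong c≈c′)

  b₄-determined : ∀ {M b₂ b₄ b₅ c₂ c₄ c₅} → b₂ ≈ 1# → c₄ ≈ 1# → b₅ ≈ 1# →
    M - b₂ - c₂ ≈ (M - b₄ - c₄) + (M - b₅ - c₅) → b₄ ≈ M - 1# + c₂ - c₅
  b₄-determined {M} {b₄ = b₄} {c₂ = c₂} {c₅ = c₅} b₂≈1 c₄≈1 b₅≈1 a₂≈a₄+a₅ =
    follows-from 1#
      (solve 4 (λ M b₄ c₂ c₅ → let one = con (+ 1) in
         b₄ :- (M :- one :+ c₂ :- c₅)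
         := one :* ((M :- one :- c₂) :- ((M :- b₄ :- one) :+ (M :- one :- c₅))))
       refl M b₄ c₂ c₅)
      (trans (sym (a-cong b₂≈1 refl))
        (trans a₂≈a₄+a₅ (+-cong (a-cong refl c₄≈1) (a-cong b₅≈1 refl))))

  -- The array written explicitly in its free parameters M = m, c₂, b₃, c₅,
  -- using c₃ = M - b₃ and the value of b₄ forced above (and c₇ = 1).
  module ExplicitArray (M c₂ b₃ c₅ : Carrier) where
    b′ : ℕ → Carrier
    b′ 0 = M
    b′ 1 = M - 1#
    b′ 2 = 1#
    b′ 3 = b₃
    b′ 4 = M - 1# + c₂ - c₅
    b′ 5 = 1#
    b′ _ = 0#

    c′ : ℕ → Carrier
    c′ 0 = 0#
    c′ 1 = 1#
    c′ 2 = c₂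
    c′ 3 = M - b₃
    c′ 4 = 1#
    c′ 5 = c₅
    c′ 6 = M
    c′ 7 = 1#
    c′ _ = 0#

    a′ : ℕ → Carrier
    a′ i = M - b′ i - c′ i

    leading-explicit : leading c′ 7 ≈ M * c₂ * c′ 3 * c₅
    leading-explicit = solve 4 (λ M c₂ b₃ c₅ → let one = con (+ 1) in
      one :* one :* c₂ :* (M :- b₃) :* one :* c₅ :* M :* one := M :* c₂ :* (M :- b₃) :* c₅)
      refl M c₂ b₃ c₅

  factored : (x M c₂ a₂ a₅ c₃ : Carrier) → Carrier
  factored x M c₂ a₂ a₅ c₃ =
    (x * x * x - a₂ * (x * x) - (M + c₂ * (M - 1#)) * x + M * a₂ - a₅ * c₃)
    * (x * x + c₂ * x - M) * (x - M) * (x + 1#)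

  factored-cong : ∀ {x M c₂ a₂ a₂′ a₅ a₅′ c₃ c₃′} → a₂ ≈ a₂′ → a₅ ≈ a₅′ → c₃ ≈ c₃′ →
    factored x M c₂ a₂ a₅ c₃ ≈ factored x M c₂ a₂′ a₅′ c₃′
  factored-cong a₂≈ a₅≈ c₃≈ = *-congʳ (*-congʳ (*-congʳ
    (+-cong (+-cong (+-congʳ (+-congˡ (-‿cong (*-congʳ a₂≈)))) (*-congˡ a₂≈))
            (-‿cong (*-cong a₅≈ c₃≈)))))

  closed-form : ∀ x M c₂ b₃ c₅ → let open ExplicitArray M c₂ b₃ c₅ in
    scaled x a′ b′ c′ 7 ≈ factored x M c₂ (a′ 2) (a′ 5) (c′ 3)
  closed-form = solve 5 (λ x M c₂ b₃ c₅ →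
    let one = con (+ 1)
        b₀ = M ; b₁ = M :- one ; b₂ = one ; b₄ = M :- one :+ c₂ :- c₅ ; b₅ = one ; b₆ = con (+ 0)
        c₁ = one ; c₃ = M :- b₃ ; c₄ = one ; c₆ = M
        a₁ = M :- b₁ :- c₁ ; a₂ = M :- b₂ :- c₂ ; a₃ = M :- b₃ :- c₃
        a₄ = M :- b₄ :- c₄ ; a₅ = M :- b₅ :- c₅ ; a₆ = M :- b₆ :- c₆
        s₁ = c₁ :* x
        s₂ = (x :- a₁) :* s₁ :- b₀ :* c₁ :* one
        s₃ = (x :- a₂) :* s₂ :- b₁ :* c₂ :* s₁
        s₄ = (x :- a₃) :* s₃ :- b₂ :* c₃ :* s₂
        s₅ = (x :- a₄) :* s₄ :- b₃ :* c₄ :* s₃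
        s₆ = (x :- a₅) :* s₅ :- b₄ :* c₅ :* s₄
        s₇ = (x :- a₆) :* s₆ :- b₅ :* c₆ :* s₅
    in s₇ := (x :* x :* x :- a₂ :* (x :* x) :- (M :+ c₂ :* (M :- one)) :* x :+ M :* a₂ :- a₅ :* c₃)
             :* (x :* x :+ c₂ :* x :- M) :* (x :- M) :* (x :+ one)) refl

  module _ (q : Fin 7 → Fin 7 → Fin 7 → Carrier) (m : ℕ) where
    open KreinArray F q m
    open ExplicitArray (ℕ→F F m) (c* 2) (b* 3) (c* 5)
    private M = ℕ→F F m

    b*-explicit : b* 0 ≈ M → b* 1 ≈ M - 1# → b* 2 ≈ 1# → b* 4 ≈ M - 1# + c* 2 - c* 5 →
      b* 5 ≈ 1# → ∀ i → b* i ≈ b′ i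
    b*-explicit hb₀ hb₁ hb₂ hb₄ hb₅ 0 = hb₀
    b*-explicit hb₀ hb₁ hb₂ hb₄ hb₅ 1 = hb₁
    b*-explicit hb₀ hb₁ hb₂ hb₄ hb₅ 2 = hb₂
    b*-explicit hb₀ hb₁ hb₂ hb₄ hb₅ 3 = refl
    b*-explicit hb₀ hb₁ hb₂ hb₄ hb₅ 4 = hb₄
    b*-explicit hb₀ hb₁ hb₂ hb₄ hb₅ 5 = hb₅
    b*-explicit hb₀ hb₁ hb₂ hb₄ hb₅ (suc (suc (suc (suc (suc (suc _)))))) = refl

    c*-explicit : c* 1 ≈ 1# → c* 3 ≈ M - b* 3 → c* 4 ≈ 1# → c* 6 ≈ M → ∀ i → c* i ≈ c′ i
    c*-explicit hc₁ hc₃ hc₄ hc₆ 0 = refl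
    c*-explicit hc₁ hc₃ hc₄ hc₆ 1 = hc₁
    c*-explicit hc₁ hc₃ hc₄ hc₆ 2 = refl
    c*-explicit hc₁ hc₃ hc₄ hc₆ 3 = hc₃
    c*-explicit hc₁ hc₃ hc₄ hc₆ 4 = hc₄
    c*-explicit hc₁ hc₃ hc₄ hc₆ 5 = refl
    c*-explicit hc₁ hc₃ hc₄ hc₆ 6 = hc₆
    c*-explicit hc₁ hc₃ hc₄ hc₆ 7 = refl
    c*-explicit hc₁ hc₃ hc₄ hc₆ (suc (suc (suc (suc (suc (suc (suc (suc _)))))))) = refl

lemma4p1 : ∀ {c ℓ : Level} (F : CommutativeRing c ℓ) →
  let open CommutativeRing F in
  IsFieldCR F → CharZero F →
  (n : ℕ) (S : SymAssocScheme F n 6) (E : Fin 7 → Mat F n) →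
  PrimitiveIdempotents F S E →
  (q : Fin 7 → Fin 7 → Fin 7 → Carrier) → KreinParameters F E q →
  Cometric F q →
  SymAssocScheme.Imprimitive S →
  (m : ℕ) → HasRank F (E (Data.Fin.suc Data.Fin.zero)) m → 2 < m →
  let open KreinArray F q m
      M = ℕ→F F m in
  b* 0 ≈ M → b* 1 ≈ M - 1# → b* 2 ≈ 1# → b* 5 ≈ 1# →
  c* 1 ≈ 1# → c* 4 ≈ 1# → c* 6 ≈ M → c* 3 ≈ M - b* 3 →
  a* 2 ≈ a* 4 + a* 5 →
  (x : Carrier) (v : ℕ → Carrier) →
  v 0 ≈ 1# → v 1 ≈ x →
  (∀ k → k ≤ 5 →
    x * v (suc k) ≈ c* (suc (suc k)) * v (suc (suc k)) + a* (suc k) * v (suc k) + b* k * v k) →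
  M * c* 2 * c* 3 * c* 5 * v 7 ≈
    (x * x * x - a* 2 * (x * x) - (M + c* 2 * (M - 1#)) * x + M * a* 2 - a* 5 * c* 3)
    * (x * x + c* 2 * x - M) * (x - M) * (x + 1#)
lemma4p1 F _ _ _ _ _ _ q _ _ _ m _ _ hb₀ hb₁ hb₂ hb₅ hc₁ hc₄ hc₆ hc₃ a₂≈a₄+a₅ x v v₀≈1 v₁≈x rec =
  begin
    M * c* 2 * c* 3 * c* 5 * v 7        ≈⟨ *-congʳ (*-congʳ (*-congˡ hc₃)) ⟩
    M * c* 2 * c′ 3 * c* 5 * v 7        ≈⟨ *-congʳ leading-explicit ⟨
    leading c′ 7 * v 7                  ≈⟨ *-congʳ (leading-cong c*≈c′ 7) ⟨
    leading c* 7 * v 7                  ≈⟨ scaled-solution {x} {a*} {b*} {c*} 5 v v₀≈1 v₁≈x rec 7 ℕ.≤-refl ⟩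
    scaled x a* b* c* 7                 ≈⟨ scaled-cong a*≈a′ b*≈b′ c*≈c′ 7 ⟩
    scaled x a′ b′ c′ 7                 ≈⟨ closed-form x M (c* 2) (b* 3) (c* 5) ⟩
    factored x M (c* 2) (a′ 2) (a′ 5) (c′ 3)
      ≈⟨ factored-cong (sym (a*≈a′ 2)) (sym (a*≈a′ 5)) (sym hc₃) ⟩
    factored x M (c* 2) (a* 2) (a* 5) (c* 3) ∎
  where
  open CommutativeRing F
  open import Relation.Binary.Reasoning.Setoid setoid
  open ThreeTermRecurrence F
  open SixClassKreinArray F
  open KreinArray F q m
  M = ℕ→F F m
  open ExplicitArray M (c* 2) (b* 3) (c* 5)

  hb₄ : b* 4 ≈ M - 1# + c* 2 - c* 5
  hb₄ = b₄-determined hb₂ hc₄ hb₅ a₂≈a₄+a₅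

  b*≈b′ : ∀ i → b* i ≈ b′ i
  b*≈b′ = b*-explicit q m hb₀ hb₁ hb₂ hb₄ hb₅

  c*≈c′ : ∀ i → c* i ≈ c′ i
  c*≈c′ = c*-explicit q m hc₁ hc₃ hc₄ hc₆

  a*≈a′ : ∀ i → a* i ≈ a′ i
  a*≈a′ i = a-cong (b*≈b′ i) (c*≈c′ i)
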